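{- Let $m\ge1$ and $\alpha,\beta^1,\dots,\beta^m\in\mathrm{ord}$. If $\alpha<\beta^1,\dots,\beta^m$, then $\alpha\le\beta^1,\dots,\beta^m$.
   Context: The setting is constructive. Let $\mathfrak F$ be a set of index sets containing $\mathbb N$ and every $\mathbb N_k=\{n\in\mathbb N:n<k\}$, closed (up to isomorphism) under finitely enumerated subsets, sets of finitely enumerated subsets, and disjoint unions indexed by elements of $\mathfrak F$. The set $\mathrm{ord}=\mathrm{ord}_{\mathfrak F}$ is defined inductively: a distinguished element $\underline 0$, and for every $I\in\mathfrak F$ and family $(\alpha_i)_{i\in I}$ in $\mathrm{ord}$ an element $\mathrm S(\alpha_i)_{i\in I}$. For $\alpha=\mathrm S(\alpha_i)_{i\in I}$, $\mathrm{In}_\alpha=I$; by convention $\mathrm{In}_{\underline0}=\emptyset$. For a finite list $F\subseteq_f\mathrm{In}_\alpha$, $\alpha_F$ is the list of the $\alpha_i$, $i\in F$. By simultaneous induction ($m\ge1$): $\alpha\le\beta^1,\dots,\beta^m$ means $\alpha_i<\beta^1,\dots,\beta^m$ for all $i\in\mathrm{In}_\alpha$; $\alpha<\beta^1,\dots,\beta^m$ means there exist finite lists $F_k\subseteq_f\mathrm{In}_{\beta^k}$, not all empty, with $\alpha\le\beta^1_{F_1},\dots,\beta^m_{F_m}$ (the concatenated list). -}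

module Defs where

open import Data.Empty using (⊥)
open import Data.Unit using (⊤)
open import Data.Product using (_×_; _,_)
open import Data.List using (List; []; _∷_; _++_; map)

-- The index-set family 𝔉 is modelled as a universe à la Tarski:
-- codes  Code  and decoding  El : Code → Set.
module _ {Code : Set} (El : Code → Set) where

  data Ord : Set where
    𝟎 : Ord
    S : (c : Code) → (El c → Ord) → Ord

  In : Ord → Set
  In 𝟎       = ⊥
  In (S c _) = El c

  comp : (α : Ord) → In α → Ord
  comp 𝟎       ()
  comp (S c f) i = f i

  sub : (α : Ord) → List (In α) → List Ord
  sub α F = map (comp α) F

  Choice : List Ord → Set
  Choice []       = ⊤
  Choice (β ∷ βs) = List (In β) × Choice βs

  select : (βs : List Ord) → Choice βs → List Ord
  select []       _        = []
  select (β ∷ βs) (F , Fs) = sub β F ++ select βs Fs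

  AllEmpty : (βs : List Ord) → Choice βs → Set
  AllEmpty []       _                = ⊤
  AllEmpty (β ∷ βs) ([]    , Fs) = AllEmpty βs Fs
  AllEmpty (β ∷ βs) (_ ∷ _ , Fs) = ⊥

  data _≤*_ : Ord → List Ord → Set
  data _<*_ : Ord → List Ord → Set

  data _≤*_ where
    le : ∀ {α βs} → (∀ (i : In α) → comp α i <* βs) → α ≤* βs

  data _<*_ where
    lt : ∀ {α βs} (Fs : Choice βs) → (AllEmpty βs Fs → ⊥) →
         α ≤* select βs Fs → α <* βs

{-# OPTIONS --safe #-}
module Submission where

-- Every selected component β^k_j satisfies β^k_j < β^1,…,β^m: select only j from β^k and use
-- β^k_j ≤ β^k_j.  Moreover < is transitive in the form "γ < δ⃗ and δ < β⃗ for all δ ∈ δ⃗ imply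
-- γ < β⃗", because the finitely many witnessing choices F_k can be merged by concatenation.
-- Hence α < β⃗ gives α_i < β⃗_F⃗ for each i, and so α_i < β⃗.

open import Defs
open import Data.Nat using (_≤_)
open import Data.List using (List; length; []; _∷_; _++_)
open import Data.List.Relation.Unary.Any using (here; there)
open import Data.List.Membership.Propositional using (_∈_)
open import Data.List.Membership.Propositional.Properties using (∈-++⁻; ∈-map⁻)
open import Data.List.Relation.Binary.Subset.Propositional using (_⊆_)
open import Data.List.Relation.Binary.Subset.Propositional.Properties
  using (map⁺; ++⁺; xs⊆xs++ys; xs⊆ys++xs)
open import Data.Product using (∃; _,_)
open import Data.Sum using (inj₁; inj₂)
open import Data.Unit using (tt)
open import Function using (id)
open import Relation.Nullary using (¬_)
open import Relation.Binary.PropositionalEquality using (_≡_; refl; subst)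

module _ {Code : Set} (El : Code → Set) where

  private
    O : Set
    O = Ord El

    _≼_ : O → List O → Set
    _≼_ = _≤*_ El

    _≺_ : O → List O → Set
    _≺_ = _<*_ El

  ∅ : (βs : List O) → Choice El βs
  ∅ []       = tt
  ∅ (β ∷ βs) = [] , ∅ βs

  _∪_ : {βs : List O} → Choice El βs → Choice El βs → Choice El βs
  _∪_ {[]}     _       _       = tt
  _∪_ {β ∷ βs} (F , A) (G , B) = F ++ G , A ∪ B

  pick : {βs : List O} {β : O} → β ∈ βs → In El β → Choice El βs
  pick {β ∷ βs} (here refl) j = j ∷ [] , ∅ βs
  pick {β ∷ βs} (there β∈)  j = [] , pick β∈ j

  ∈-select-pick : {βs : List O} {β : O} (β∈ : β ∈ βs) (j : In El β) →
                  comp El β j ∈ select El βs (pick β∈ j)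
  ∈-select-pick {β ∷ βs} (here refl) j = here refl
  ∈-select-pick {β ∷ βs} (there β∈)  j = ∈-select-pick β∈ j

  select-∪ˡ : (βs : List O) (A B : Choice El βs) → select El βs A ⊆ select El βs (A ∪ B)
  select-∪ˡ []       _       _       ()
  select-∪ˡ (β ∷ βs) (F , A) (G , B) =
    ++⁺ (map⁺ (comp El β) (xs⊆xs++ys F G)) (select-∪ˡ βs A B)

  select-∪ʳ : (βs : List O) (A B : Choice El βs) → select El βs B ⊆ select El βs (A ∪ B)
  select-∪ʳ []       _       _       ()
  select-∪ʳ (β ∷ βs) (F , A) (G , B) =
    ++⁺ (map⁺ (comp El β) (xs⊆ys++xs G F)) (select-∪ʳ βs A B)

  select-elim : {P : O → Set} (βs : List O) (H : Choice El βs) →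
                (∀ {β} → β ∈ βs → (j : In El β) → P (comp El β j)) →
                ∀ {δ} → δ ∈ select El βs H → P δ
  select-elim (β ∷ βs) (F , H) p δ∈ with ∈-++⁻ (sub El β F) δ∈
  ... | inj₂ δ∈rest = select-elim βs H (λ β∈ → p (there β∈)) δ∈rest
  ... | inj₁ δ∈βF with ∈-map⁻ (comp El β) δ∈βF
  ...   | j , _ , refl = p (here refl) j

  AllEmpty⇒select≡[] : (βs : List O) (H : Choice El βs) → AllEmpty El βs H → select El βs H ≡ []
  AllEmpty⇒select≡[] []       _            _ = refl
  AllEmpty⇒select≡[] (β ∷ βs) ([] , H)     e = AllEmpty⇒select≡[] βs H e
  AllEmpty⇒select≡[] (β ∷ βs) (_ ∷ _ , H) ()

  ¬AllEmpty⇒∃∈select : (βs : List O) (H : Choice El βs) → ¬ AllEmpty El βs H →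
                       ∃ λ δ → δ ∈ select El βs H
  ¬AllEmpty⇒∃∈select []       _            ne with ne tt
  ... | ()
  ¬AllEmpty⇒∃∈select (β ∷ βs) ([] , H)     ne = ¬AllEmpty⇒∃∈select βs H ne
  ¬AllEmpty⇒∃∈select (β ∷ βs) (j ∷ _ , H) _  = comp El β j , here refl

  ∈-select⇒¬AllEmpty : (βs : List O) (H : Choice El βs) {δ : O} →
                       δ ∈ select El βs H → ¬ AllEmpty El βs H
  ∈-select⇒¬AllEmpty βs H δ∈ e with subst (_ ∈_) (AllEmpty⇒select≡[] βs H e) δ∈
  ... | ()

  ¬≺[] : {γ : O} → ¬ (γ ≺ [])
  ¬≺[] (lt tt ne _) = ne tt

  ≺-select⇒¬AllEmpty : (βs : List O) (H : Choice El βs) {γ : O} →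
                       γ ≺ select El βs H → ¬ AllEmpty El βs H
  ≺-select⇒¬AllEmpty βs H γ≺ e = ¬≺[] (subst (_ ≺_) (AllEmpty⇒select≡[] βs H e) γ≺)

  -- Since In β may be infinite there is no largest choice; finitely many are merged with _∪_.
  merge-choices : (βs : List O) (Q : O → Choice El βs → Set) →
                  (∀ {γ A B} → select El βs A ⊆ select El βs B → Q γ A → Q γ B) →
                  (γs : List O) → (∀ {γ} → γ ∈ γs → ∃ (Q γ)) →
                  ∃ λ H → ∀ {γ} → γ ∈ γs → Q γ H
  merge-choices βs Q Q-mono []       _ = ∅ βs , λ ()
  merge-choices βs Q Q-mono (γ ∷ γs) q
    with q (here refl) | merge-choices βs Q Q-mono γs (λ γ∈ → q (there γ∈))
  ... | A , qA | B , qB = A ∪ B , λ where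
    (here refl) → Q-mono (select-∪ˡ βs A B) qA
    (there γ∈)  → Q-mono (select-∪ʳ βs A B) (qB γ∈)

  ≼-mono : ∀ {γ L L'} → γ ≼ L → L ⊆ L' → γ ≼ L'
  ≺-mono : ∀ {γ L L'} → γ ≺ L → L ⊆ L' → γ ≺ L'
  ≼-mono (le f) L⊆L' = le λ i → ≺-mono (f i) L⊆L'
  ≺-mono {L = L} {L'} (lt F ne γ≼LF) L⊆L' =
    let H , LF⊆L'H = merge-choices L' (λ δ H → δ ∈ select El L' H) (λ A⊆B → A⊆B) (select El L F)
                       (select-elim L F λ β∈ j → pick (L⊆L' β∈) j , ∈-select-pick (L⊆L' β∈) j)
        _ , δ∈LF   = ¬AllEmpty⇒∃∈select L F ne
    in lt H (∈-select⇒¬AllEmpty L' H (LF⊆L'H δ∈LF)) (≼-mono γ≼LF LF⊆L'H)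

  comp-≺-select : {β : O} {M : List O} → β ≺ M → (j : In El β) →
                  ∃ λ H → comp El β j ≺ select El M H
  comp-≺-select (lt H _ (le g)) j = H , g j

  ≼-trans : ∀ {γ K M} → γ ≼ K → (∀ {δ} → δ ∈ K → δ ≺ M) → γ ≼ M
  ≺-trans : ∀ {γ K M} → γ ≺ K → (∀ {δ} → δ ∈ K → δ ≺ M) → γ ≺ M
  ≼-trans (le f) K≺M = le λ i → ≺-trans (f i) K≺M
  ≺-trans {K = K} {M} (lt G ne γ≼KG) K≺M =
    let H , KG≺MH = merge-choices M (λ δ H → δ ≺ select El M H) (λ A⊆B δ≺ → ≺-mono δ≺ A⊆B)
                      (select El K G) (select-elim K G λ β∈ → comp-≺-select (K≺M β∈))
        _ , δ∈KG  = ¬AllEmpty⇒∃∈select K G ne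
    in lt H (≺-select⇒¬AllEmpty M H (KG≺MH δ∈KG)) (≼-trans γ≼KG KG≺MH)

  ≼-refl : (δ : O) → δ ≼ (δ ∷ [])
  ≼-refl 𝟎       = le λ ()
  ≼-refl (S c f) = le λ i → lt (i ∷ [] , tt) id (≼-refl (f i))

  comp-≺ : {β : O} {βs : List O} → β ∈ βs → (j : In El β) → comp El β j ≺ βs
  comp-≺ {β} {βs} β∈ j =
    lt (pick β∈ j) (∈-select⇒¬AllEmpty βs _ picked) (≼-mono (≼-refl _) λ { (here refl) → picked })
    where
    picked : comp El β j ∈ select El βs (pick β∈ j)
    picked = ∈-select-pick β∈ j

  ≺⇒≼ : ∀ {α βs} → α ≺ βs → α ≼ βs
  ≺⇒≼ {βs = βs} (lt F _ (le f)) = le λ i → ≺-trans (f i) (select-elim βs F comp-≺)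

lemma4p3 : {Code : Set} (El : Code → Set) (α : Ord El) (βs : List (Ord El)) →
    1 ≤ length βs → _<*_ El α βs → _≤*_ El α βs
lemma4p3 El α βs _ = ≺⇒≼ El
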